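{- Let $G$ be a digraph and let $\mathcal{T}$ be a tangle in $G$ of order $k$. For every set $X\subseteq V(G)$ with $|X|<k$ there is exactly one strong component $C(X)$ of $G-X$ such that $C(X)\subseteq B$ for all $(A,B)\in\mathcal{T}$ with $V(A)\cap V(B)=X$.
   Context: A directed separation of $G$ is a pair $(A,B)$ of subgraphs with $V(A)\cup V(B)=V(G)$ such that either no edge has tail in $V(A)\setminus V(B)$ and head in $V(B)\setminus V(A)$, or no edge has tail in $V(B)\setminus V(A)$ and head in $V(A)\setminus V(B)$; its order is $|V(A)\cap V(B)|$. A tangle of order $k$ in $G$ is a set $\mathcal{T}$ of directed separations of order $<k$ such that (i) for every directed separation $(A,B)$ of order $<k$, $(A,B)\in\mathcal{T}$ or $(B,A)\in\mathcal{T}$, and (ii) for all (not necessarily distinct) $(A_1,B_1),(A_2,B_2),(A_3,B_3)\in\mathcal{T}$, $V(A_1)\cup V(A_2)\cup V(A_3)\neq V(G)$. Strong components are the strongly connected components. -}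

module Defs where

open import Data.Nat using (ℕ; _<_)
open import Data.Bool using (Bool; true)
open import Data.Fin using (Fin)
open import Data.Fin.Subset using (Subset; _∈_; _∉_; _⊆_; _∪_; _∩_; ∁; ⊤; ∣_∣)
open import Data.Product using (Σ; ∃; _×_)
open import Data.Sum using (_⊎_)
open import Data.Empty using (⊥)
open import Relation.Binary.PropositionalEquality using (_≡_; _≢_)

-- A (finite) digraph on vertex set Fin n, given by its adjacency relation
-- (edge u → v present iff adj u v ≡ true). Parallel edges are irrelevant here.
record Digraph : Set where
  field
    n   : ℕ
    adj : Fin n → Fin n → Bool
open Digraph public

record Subgraph (G : Digraph) : Set where
  field
    vs : Subset (n G)
    es : Fin (n G) → Fin (n G) → Bool
    es-ok : ∀ u v → es u v ≡ true → (adj G u v ≡ true) × (u ∈ vs) × (v ∈ vs)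
open Subgraph public

NoEdgeFromTo : (G : Digraph) → Subset (n G) → Subset (n G) → Set
NoEdgeFromTo G VA VB = ∀ u v → adj G u v ≡ true →
  u ∈ VA → u ∉ VB → v ∈ VB → v ∉ VA → ⊥

IsDirSep : (G : Digraph) → Subgraph G → Subgraph G → Set
IsDirSep G A B = (vs A ∪ vs B ≡ ⊤)
  × (NoEdgeFromTo G (vs A) (vs B) ⊎ NoEdgeFromTo G (vs B) (vs A))

order : {G : Digraph} → Subgraph G → Subgraph G → ℕ
order A B = ∣ vs A ∩ vs B ∣

record IsTangle (G : Digraph) (k : ℕ) (T : Subgraph G → Subgraph G → Set) : Set where
  field
    members : ∀ A B → T A B → IsDirSep G A B × order A B < k
    orient  : ∀ A B → IsDirSep G A B → order A B < k → T A B ⊎ T B A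
    cover   : ∀ A₁ B₁ A₂ B₂ A₃ B₃ → T A₁ B₁ → T A₂ B₂ → T A₃ B₃ →
              (vs A₁ ∪ vs A₂ ∪ vs A₃) ≢ ⊤

data Reach (G : Digraph) (S : Subset (n G)) : Fin (n G) → Fin (n G) → Set where
  here : ∀ {u} → u ∈ S → Reach G S u u
  step : ∀ {u w v} → u ∈ S → adj G u w ≡ true → Reach G S w v → Reach G S u v

IsStrongComponentMinus : (G : Digraph) → Subset (n G) → Subset (n G) → Set
IsStrongComponentMinus G X C =
  (C ⊆ ∁ X)
  × (∃ λ u → u ∈ C)
  × (∀ u v → u ∈ C → v ∈ C → Reach G (∁ X) u v)
  × (∀ u v → u ∈ C → v ∈ ∁ X → Reach G (∁ X) u v → Reach G (∁ X) v u → v ∈ C)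

-- Call a vertex set D of G − X in-closed if every edge of G − X ending in D
-- starts in D.  Then (D ∪ X , V ∖ D) is a directed separation with separator X,
-- and the tangle declares D small or large; ∅ is small and V ∖ X is large.
-- Keep a small in-closed E and a large in-closed F and pick v ∈ F ∖ E.  If
-- E ∪ Anc(v) is small it replaces E; if E ∪ (Anc(v) ∖ Desc(v)) is large it
-- replaces F; either way F ∖ E shrinks.  Otherwise E′ = E ∪ (Anc(v) ∖ Desc(v))
-- is small, F′ = E ∪ Anc(v) is large, and F′ ∖ E′ lies in the strong component
-- C of v.  A separation (A, B) ∈ T with separator X leaving a vertex of C
-- outside B has C ⊆ A, because the strongly connected C cannot cross the
-- separation both ways; then A, E′ ∪ X and V ∖ F′ would cover V.  Every strong
-- component lying in all these B meets F′ ∖ E′, hence meets C, hence equals C.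
module Submission where

open import Defs
open import Level using (0ℓ)
open import Function using (_∘_)
open import Function.Bundles using (Equivalence)
open import Data.Nat using (ℕ; _<_)
open import Data.Bool using (true; false)
import Data.Bool as Bool
open import Data.Bool.Properties using (T-≡)
open import Data.Fin using (Fin) renaming (_≟_ to _≟ᶠ_)
open import Data.Fin.Properties using (any?)
open import Data.Fin.Subset
  using (Subset; _∈_; _∉_; _⊆_; _⊂_; _∪_; _∩_; _─_; _-_; ∁; ⊤; ⁅_⁆; ∣_∣)
  renaming (⊥ to ∅)
open import Data.Fin.Subset.Properties
  using ( _∈?_; nonempty?; ∈⊤; ⊆⊤; ∉⊥; ⊆-antisym; ∩-comm; ∪-comm; x∈⁅x⁆
        ; x∈p∪q⁺; x∈p∪q⁻; x∈p∩q⁺; x∈p∩q⁻; x∈∁p⇒x∉p; x∉p⇒x∈∁p; x∉∁p⇒x∈p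
        ; p─q⊆p; x∈p∧x∉q⇒x∈p─q; x∈p∧x≢y⇒x∈p-y; x∈p⇒p-x⊂p )
open import Data.Fin.Subset.Induction using (⊂-wellFounded)
open import Induction.WellFounded using (Acc; acc)
open import Data.Vec using (tabulate; _∷_)
import Data.Vec.Base as Vec
open import Data.Vec.Properties using (lookup∘tabulate; lookup⇒[]=; []=⇒lookup)
open import Data.Product using (Σ; _×_; _,_; proj₁; proj₂; ∃-syntax)
open import Data.Sum using (_⊎_; inj₁; inj₂)
open import Data.Empty using (⊥; ⊥-elim)
open import Relation.Unary using (Pred; Decidable)
open import Relation.Nullary using (Dec; yes; no; isYes)
open import Relation.Nullary.Decidable
  using (_×-dec_; ¬?; map′; fromWitness; toWitness; decidable-stable)
open import Relation.Binary.PropositionalEquality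
  using (_≡_; _≢_; refl; sym; trans; subst)

x∈p─q⇒x∉q : ∀ {m} {p q : Subset m} {x} → x ∈ p ─ q → x ∉ q
x∈p─q⇒x∉q {p = _ ∷ _} {true ∷ _} () Vec.here
x∈p─q⇒x∉q {p = _ ∷ _} {_ ∷ _} (Vec.there x∈p─q) (Vec.there x∈q) = x∈p─q⇒x∉q x∈p─q x∈q

module _ {m : ℕ} {P : Pred (Fin m) 0ℓ} (P? : Decidable P) where

  subsetOf : Subset m
  subsetOf = tabulate (λ x → isYes (P? x))

  ∈-subsetOf⁺ : ∀ {x} → P x → x ∈ subsetOf
  ∈-subsetOf⁺ {x} px =
    lookup⇒[]= x subsetOf (trans (lookup∘tabulate _ x) (Equivalence.to T-≡ (fromWitness px)))

  ∈-subsetOf⁻ : ∀ {x} → x ∈ subsetOf → P x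
  ∈-subsetOf⁻ {x} x∈ = toWitness {a? = P? x}
    (Equivalence.from T-≡ (trans (sym (lookup∘tabulate _ x)) ([]=⇒lookup x∈)))

module _ {m : ℕ} {p q r : Subset m} where

  ∪-─-∪-⊆ : (r ∪ p) ─ (r ∪ q) ⊆ p ─ q
  ∪-─-∪-⊆ {x} x∈ with x∈p∪q⁻ r p (p─q⊆p (r ∪ p) (r ∪ q) x∈)
  ... | inj₁ x∈r = ⊥-elim (x∈p─q⇒x∉q x∈ (x∈p∪q⁺ (inj₁ x∈r)))
  ... | inj₂ x∈p = x∈p∧x∉q⇒x∈p─q x∈p (x∈p─q⇒x∉q x∈ ∘ x∈p∪q⁺ ∘ inj₂)

  ─-∪-⊂ : ∀ {x} → x ∈ p ─ q → x ∈ r → p ─ (q ∪ r) ⊂ p ─ q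
  ─-∪-⊂ {x} x∈p─q x∈r = shrink , x , x∈p─q , λ x∈ → x∈p─q⇒x∉q x∈ (x∈p∪q⁺ (inj₂ x∈r))
    where
    shrink : p ─ (q ∪ r) ⊆ p ─ q
    shrink y∈ = x∈p∧x∉q⇒x∈p─q (p─q⊆p p _ y∈) (x∈p─q⇒x∉q y∈ ∘ x∈p∪q⁺ ∘ inj₁)

  ∪-─ˡ⊆ʳ : (q ∪ r) ─ q ⊆ r
  ∪-─ˡ⊆ʳ {x} x∈ with x∈p∪q⁻ q r (p─q⊆p (q ∪ r) q x∈)
  ... | inj₁ x∈q = ⊥-elim (x∈p─q⇒x∉q x∈ x∈q)
  ... | inj₂ x∈r = x∈r

  ∪-─-⊂ : ∀ {x} → r ⊆ p → x ∈ p ─ q → x ∉ r → (q ∪ r) ─ q ⊂ p ─ q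
  ∪-─-⊂ {x} r⊆p x∈p─q x∉r = grow , x , x∈p─q , x∉r ∘ ∪-─ˡ⊆ʳ
    where
    grow : (q ∪ r) ─ q ⊆ p ─ q
    grow y∈ = x∈p∧x∉q⇒x∈p─q (r⊆p (∪-─ˡ⊆ʳ y∈)) (x∈p─q⇒x∉q y∈)

module Walks (G : Digraph) where

  private variable
    S S′ : Subset (n G)
    u v w x : Fin (n G)

  Reach-source : Reach G S u v → u ∈ S
  Reach-source (here u∈S)     = u∈S
  Reach-source (step u∈S _ _) = u∈S

  Reach-trans : Reach G S u w → Reach G S w v → Reach G S u v
  Reach-trans (here _)       r = r
  Reach-trans (step u∈S e p) r = step u∈S e (Reach-trans p r)

  Reach-mono : S ⊆ S′ → Reach G S u v → Reach G S′ u v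
  Reach-mono S⊆S′ (here u∈S)     = here (S⊆S′ u∈S)
  Reach-mono S⊆S′ (step u∈S e r) = step (S⊆S′ u∈S) e (Reach-mono S⊆S′ r)

  Reach-lastVisit : ∀ u → Reach G S x v →
    Reach G (S - u) x v ⊎ u ≡ v ⊎ (∃[ w ] adj G u w ≡ true × Reach G (S - u) w v)
  Reach-lastVisit {x = x} u (here x∈S) with x ≟ᶠ u
  ... | yes refl = inj₂ (inj₁ refl)
  ... | no x≢u   = inj₁ (here (x∈p∧x≢y⇒x∈p-y x∈S x≢u))
  Reach-lastVisit {x = x} u (step x∈S e r) with Reach-lastVisit u r
  ... | inj₂ later = inj₂ later
  ... | inj₁ r′ with x ≟ᶠ u
  ...   | yes refl = inj₂ (inj₂ (_ , e , r′))
  ...   | no x≢u   = inj₁ (step (x∈p∧x≢y⇒x∈p-y x∈S x≢u) e r′)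

  Reach-firstStep : Reach G S u v → u ≢ v →
    ∃[ w ] adj G u w ≡ true × Reach G (S - u) w v
  Reach-firstStep {u = u} r u≢v with Reach-lastVisit u r
  ... | inj₁ r′               = ⊥-elim (x∈p─q⇒x∉q (Reach-source r′) (x∈⁅x⁆ u))
  ... | inj₂ (inj₁ u≡v)       = ⊥-elim (u≢v u≡v)
  ... | inj₂ (inj₂ firstStep) = firstStep

  private
    Reach-acc? : ∀ S → Acc _⊂_ S → ∀ u v → Dec (Reach G S u v)
    Reach-acc? S (acc rec) u v with u ∈? S
    ... | no u∉S = no (u∉S ∘ Reach-source)
    ... | yes u∈S with u ≟ᶠ v
    ...   | yes refl = yes (here u∈S)
    ...   | no u≢v   = map′ prepend (λ r → Reach-firstStep r u≢v)
                         (any? λ w → (adj G u w Bool.≟ true)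
                                     ×-dec Reach-acc? (S - u) (rec (x∈p⇒p-x⊂p u∈S)) w v)
      where
      prepend : ∃[ w ] adj G u w ≡ true × Reach G (S - u) w v → Reach G S u v
      prepend (_ , e , r) = step u∈S e (Reach-mono (p─q⊆p S ⁅ u ⁆) r)

  Reach? : ∀ S u v → Dec (Reach G S u v)
  Reach? S = Reach-acc? S (⊂-wellFounded S)

module InClosedSets (G : Digraph) (X : Subset (n G)) where
  open Walks G

  private variable
    C C′ D D′ : Subset (n G)
    u v w : Fin (n G)

  record InClosed (D : Subset (n G)) : Set where
    field
      ⊆∁X    : D ⊆ ∁ X
      closed : adj G u w ≡ true → u ∈ ∁ X → w ∈ D → u ∈ D
  open InClosed public

  InClosed-∅ : InClosed ∅
  InClosed-∅ = record { ⊆∁X = ⊥-elim ∘ ∉⊥ ; closed = λ _ _ → ⊥-elim ∘ ∉⊥ }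

  InClosed-∁X : InClosed (∁ X)
  InClosed-∁X = record { ⊆∁X = λ u∈ → u∈ ; closed = λ _ u∈∁X _ → u∈∁X }

  InClosed-∪ : InClosed D → InClosed D′ → InClosed (D ∪ D′)
  InClosed-∪ {D} {D′} cD cD′ = record { ⊆∁X = sub ; closed = clo }
    where
    sub : D ∪ D′ ⊆ ∁ X
    sub {u} u∈ with x∈p∪q⁻ D D′ u∈
    ... | inj₁ u∈D  = ⊆∁X cD u∈D
    ... | inj₂ u∈D′ = ⊆∁X cD′ u∈D′
    clo : adj G u w ≡ true → u ∈ ∁ X → w ∈ D ∪ D′ → u ∈ D ∪ D′
    clo {w = w} e u∈∁X w∈ with x∈p∪q⁻ D D′ w∈
    ... | inj₁ w∈D  = x∈p∪q⁺ (inj₁ (closed cD e u∈∁X w∈D))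
    ... | inj₂ w∈D′ = x∈p∪q⁺ (inj₂ (closed cD′ e u∈∁X w∈D′))

  InClosed-Reach : InClosed D → Reach G (∁ X) u v → v ∈ D → u ∈ D
  InClosed-Reach cD (here _)         v∈D = v∈D
  InClosed-Reach cD (step u∈∁X e r) v∈D = closed cD e u∈∁X (InClosed-Reach cD r v∈D)

  ancestors strictAncestors component : Fin (n G) → Subset (n G)
  ancestors v       = subsetOf (λ u → Reach? (∁ X) u v)
  strictAncestors v = subsetOf (λ u → Reach? (∁ X) u v ×-dec ¬? (Reach? (∁ X) v u))
  component v       = subsetOf (λ u → Reach? (∁ X) v u ×-dec Reach? (∁ X) u v)

  v∈ancestors : v ∈ ∁ X → v ∈ ancestors v
  v∈ancestors v∈∁X = ∈-subsetOf⁺ _ (here v∈∁X)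

  v∉strictAncestors : v ∈ ∁ X → v ∉ strictAncestors v
  v∉strictAncestors v∈∁X v∈ = proj₂ (∈-subsetOf⁻ _ v∈) (here v∈∁X)

  ancestors⊆ : InClosed D → v ∈ D → ancestors v ⊆ D
  ancestors⊆ cD v∈D u∈ = InClosed-Reach cD (∈-subsetOf⁻ _ u∈) v∈D

  strictAncestors⊆ancestors : strictAncestors v ⊆ ancestors v
  strictAncestors⊆ancestors u∈ = ∈-subsetOf⁺ _ (proj₁ (∈-subsetOf⁻ _ u∈))

  InClosed-ancestors : InClosed (ancestors v)
  InClosed-ancestors = record
    { ⊆∁X    = Reach-source ∘ ∈-subsetOf⁻ _
    ; closed = λ e u∈∁X w∈ → ∈-subsetOf⁺ _ (step u∈∁X e (∈-subsetOf⁻ _ w∈))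
    }

  InClosed-strictAncestors : InClosed (strictAncestors v)
  InClosed-strictAncestors = record
    { ⊆∁X    = Reach-source ∘ proj₁ ∘ ∈-subsetOf⁻ _
    ; closed = λ e u∈∁X w∈ →
        let w↝v , v↝̸w = ∈-subsetOf⁻ _ w∈ in
        ∈-subsetOf⁺ _ ( step u∈∁X e w↝v
                      , λ v↝u → v↝̸w (Reach-trans v↝u (step u∈∁X e (here (Reach-source w↝v)))) )
    }

  ancestors─strictAncestors⊆component : ancestors v ─ strictAncestors v ⊆ component v
  ancestors─strictAncestors⊆component {v} {u} u∈ = ∈-subsetOf⁺ _ (v↝u , u↝v)
    where
    u↝v : Reach G (∁ X) u v
    u↝v = ∈-subsetOf⁻ _ (p─q⊆p (ancestors v) _ u∈)
    v↝u : Reach G (∁ X) v u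
    v↝u = decidable-stable (Reach? (∁ X) v u)
            (λ v↝̸u → x∈p─q⇒x∉q u∈ (∈-subsetOf⁺ _ (u↝v , v↝̸u)))

  component-isStrongComponent : v ∈ ∁ X → IsStrongComponentMinus G X (component v)
  component-isStrongComponent {v} v∈∁X =
      (λ u∈ → Reach-source (proj₂ (∈-subsetOf⁻ _ u∈)))
    , (v , ∈-subsetOf⁺ _ (here v∈∁X , here v∈∁X))
    , (λ u w u∈ w∈ → Reach-trans (proj₂ (∈-subsetOf⁻ _ u∈)) (proj₁ (∈-subsetOf⁻ _ w∈)))
    , (λ u w u∈ _ u↝w w↝u →
         let v↝u , u↝v = ∈-subsetOf⁻ _ u∈ in
         ∈-subsetOf⁺ _ (Reach-trans v↝u u↝w , Reach-trans w↝u u↝v))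

  strongComponents-≡ : IsStrongComponentMinus G X C → IsStrongComponentMinus G X C′ →
    w ∈ C → w ∈ C′ → C′ ≡ C
  strongComponents-≡ {w = w} (⊆∁X , _ , conn , maximal) (⊆∁X′ , _ , conn′ , maximal′) w∈C w∈C′ =
    ⊆-antisym (λ {u} u∈C′ → maximal w u w∈C (⊆∁X′ u∈C′) (conn′ w u w∈C′ u∈C′) (conn′ u w u∈C′ w∈C′))
              (λ {u} u∈C → maximal′ w u w∈C′ (⊆∁X u∈C) (conn w u w∈C u∈C) (conn u w u∈C w∈C))

module Separations (G : Digraph) (X : Subset (n G)) where
  open Walks G
  open InClosedSets G X

  private variable
    C D P Q : Subset (n G)
    u v w : Fin (n G)
    A B : Subgraph G

  -- Separations and the tangle axioms only look at vertex sets.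
  edgeless : Subset (n G) → Subgraph G
  edgeless W = record { vs = W ; es = λ _ _ → false ; es-ok = λ _ _ () }

  lower upper : Subset (n G) → Subgraph G
  lower D = edgeless (D ∪ X)
  upper D = edgeless (∁ D)

  lower∩upper≡X : D ⊆ ∁ X → (D ∪ X) ∩ ∁ D ≡ X
  lower∩upper≡X {D} D⊆∁X = ⊆-antisym ⊆X X⊆
    where
    ⊆X : (D ∪ X) ∩ ∁ D ⊆ X
    ⊆X {u} u∈ with x∈p∩q⁻ (D ∪ X) (∁ D) u∈
    ... | u∈D∪X , u∈∁D with x∈p∪q⁻ D X u∈D∪X
    ...   | inj₁ u∈D = ⊥-elim (x∈∁p⇒x∉p u∈∁D u∈D)
    ...   | inj₂ u∈X = u∈X
    X⊆ : X ⊆ (D ∪ X) ∩ ∁ D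
    X⊆ u∈X = x∈p∩q⁺ (x∈p∪q⁺ (inj₂ u∈X) , x∉p⇒x∈∁p (λ u∈D → x∈∁p⇒x∉p (D⊆∁X u∈D) u∈X))

  upper∩lower≡X : D ⊆ ∁ X → ∁ D ∩ (D ∪ X) ≡ X
  upper∩lower≡X {D} D⊆∁X = trans (∩-comm (∁ D) (D ∪ X)) (lower∩upper≡X D⊆∁X)

  InClosed⇒IsDirSep : InClosed D → IsDirSep G (lower D) (upper D)
  InClosed⇒IsDirSep {D} cD = ⊆-antisym ⊆⊤ covers , inj₂ noEdge
    where
    covers : ⊤ ⊆ (D ∪ X) ∪ ∁ D
    covers {u} _ with u ∈? D
    ... | yes u∈D = x∈p∪q⁺ (inj₁ (x∈p∪q⁺ (inj₁ u∈D)))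
    ... | no u∉D  = x∈p∪q⁺ (inj₂ (x∉p⇒x∈∁p u∉D))
    noEdge : NoEdgeFromTo G (∁ D) (D ∪ X)
    noEdge u w e u∈∁D u∉D∪X _ w∉∁D =
      x∈∁p⇒x∉p u∈∁D (closed cD e (x∉p⇒x∈∁p (u∉D∪X ∘ x∈p∪q⁺ ∘ inj₂)) (x∉∁p⇒x∈p w∉∁D))

  ∪≡⊤-resolveˡ : P ∪ Q ≡ ⊤ → u ∉ Q → u ∈ P
  ∪≡⊤-resolveˡ {P} {Q} {u} P∪Q u∉Q with x∈p∪q⁻ P Q (subst (u ∈_) (sym P∪Q) ∈⊤)
  ... | inj₁ u∈P = u∈P
  ... | inj₂ u∈Q = ⊥-elim (u∉Q u∈Q)

  ∪≡⊤-resolveʳ : P ∪ Q ≡ ⊤ → u ∉ P → u ∈ Q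
  ∪≡⊤-resolveʳ {P} {Q} {u} P∪Q u∉P with x∈p∪q⁻ P Q (subst (u ∈_) (sym P∪Q) ∈⊤)
  ... | inj₁ u∈P = ⊥-elim (u∉P u∈P)
  ... | inj₂ u∈Q = u∈Q

  -- In G − X every vertex lies on exactly one side, so a walk could only
  -- enter Q through a forbidden edge from P ∖ Q to Q ∖ P.
  Reach-avoids : NoEdgeFromTo G P Q → P ∩ Q ≡ X → P ∪ Q ≡ ⊤ →
    Reach G (∁ X) u v → u ∉ Q → v ∉ Q
  Reach-avoids noEdge P∩Q P∪Q (here _) u∉Q = u∉Q
  Reach-avoids {P} {Q} noEdge P∩Q P∪Q (step {w = w} _ e r) u∉Q with w ∈? Q
  ... | no w∉Q  = Reach-avoids noEdge P∩Q P∪Q r w∉Q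
  ... | yes w∈Q = ⊥-elim (noEdge _ w e (∪≡⊤-resolveˡ P∪Q u∉Q) u∉Q w∈Q w∉P)
    where
    w∉P : w ∉ P
    w∉P w∈P = x∈∁p⇒x∉p (Reach-source r) (subst (w ∈_) P∩Q (x∈p∩q⁺ (w∈P , w∈Q)))

  stronglyConnected-⊆-side : IsDirSep G A B → vs A ∩ vs B ≡ X →
    (∀ u v → u ∈ C → v ∈ C → Reach G (∁ X) u v) →
    w ∈ C → w ∉ vs B → C ⊆ vs A
  stronglyConnected-⊆-side {A} {B} (A∪B , noEdge) A∩B conn w∈C w∉B {u} u∈C
    with u ∈? vs A | noEdge
  ... | yes u∈A | _         = u∈A
  ... | no u∉A  | inj₁ noAB =
    ⊥-elim (Reach-avoids noAB A∩B A∪B (conn _ _ w∈C u∈C) w∉B (∪≡⊤-resolveʳ A∪B u∉A))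
  ... | no u∉A  | inj₂ noBA =
    ⊥-elim (Reach-avoids noBA (trans (∩-comm (vs B) (vs A)) A∩B)
                              (trans (∪-comm (vs B) (vs A)) A∪B)
                              (conn _ _ u∈C w∈C) u∉A (∪≡⊤-resolveˡ A∪B w∉B))

module TangleAt (G : Digraph) {k : ℕ} {T : Subgraph G → Subgraph G → Set}
                (tangle : IsTangle G k T) (X : Subset (n G)) (∣X∣<k : ∣ X ∣ < k) where
  open IsTangle tangle
  open InClosedSets G X
  open Separations G X

  private variable
    C D E F : Subset (n G)
    A₁ B₁ A₂ B₂ A₃ B₃ : Subgraph G

  Small Large : Subset (n G) → Set
  Small D = T (lower D) (upper D)
  Large D = T (upper D) (lower D)

  small⊎large : InClosed D → Small D ⊎ Large D
  small⊎large cD = orient _ _ (InClosed⇒IsDirSep cD)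
    (subst (λ S → ∣ S ∣ < k) (sym (lower∩upper≡X (⊆∁X cD))) ∣X∣<k)

  ¬covered : T A₁ B₁ → T A₂ B₂ → T A₃ B₃ →
    (∀ x → x ∈ vs A₁ ⊎ x ∈ vs A₂ ⊎ x ∈ vs A₃) → ⊥
  ¬covered {A₁} {A₂ = A₂} {A₃ = A₃} t₁ t₂ t₃ covers =
    cover _ _ _ _ _ _ t₁ t₂ t₃ (⊆-antisym ⊆⊤ λ {x} _ → ∪₃⁺ (covers x))
    where
    ∪₃⁺ : ∀ {x} → x ∈ vs A₁ ⊎ x ∈ vs A₂ ⊎ x ∈ vs A₃ → x ∈ vs A₁ ∪ vs A₂ ∪ vs A₃
    ∪₃⁺ (inj₁ x∈A₁)        = x∈p∪q⁺ (inj₁ x∈A₁)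
    ∪₃⁺ (inj₂ (inj₁ x∈A₂)) = x∈p∪q⁺ (inj₂ (x∈p∪q⁺ (inj₁ x∈A₂)))
    ∪₃⁺ (inj₂ (inj₂ x∈A₃)) = x∈p∪q⁺ (inj₂ (x∈p∪q⁺ (inj₂ x∈A₃)))

  Small-∅ : Small ∅
  Small-∅ with small⊎large InClosed-∅
  ... | inj₁ small = small
  ... | inj₂ large = ⊥-elim (¬covered large large large λ _ → inj₁ (x∉p⇒x∈∁p ∉⊥))

  Large-∁X : Large (∁ X)
  Large-∁X with small⊎large InClosed-∁X
  ... | inj₂ large = large
  ... | inj₁ small = ⊥-elim (¬covered small small small λ x → inj₁ (x∈∁X∪X x))
    where
    x∈∁X∪X : ∀ x → x ∈ ∁ X ∪ X
    x∈∁X∪X x with x ∈? X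
    ... | yes x∈X = x∈p∪q⁺ (inj₂ x∈X)
    ... | no x∉X  = x∈p∪q⁺ (inj₁ (x∉p⇒x∈∁p x∉X))

  record Sandwich : Set where
    field
      centre    : Fin (n G)
      centre∈∁X : centre ∈ ∁ X
      lo hi     : Subset (n G)
      lo-closed : InClosed lo
      hi-closed : InClosed hi
      lo-small  : Small lo
      hi-large  : Large hi
      hi─lo⊆component : hi ─ lo ⊆ component centre

  sandwich : InClosed E → InClosed F → Small E → Large F → Acc _⊂_ (F ─ E) → Sandwich
  sandwich {E} {F} cE cF sE lF (acc rec) with nonempty? (F ─ E)
  ... | no F─E-empty = ⊥-elim (¬covered sE lF lF covers)
    where
    covers : ∀ x → x ∈ E ∪ X ⊎ x ∈ ∁ F ⊎ x ∈ ∁ F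
    covers x with x ∈? E | x ∈? F
    ... | yes x∈E | _       = inj₁ (x∈p∪q⁺ (inj₁ x∈E))
    ... | no x∉E  | yes x∈F = ⊥-elim (F─E-empty (x , x∈p∧x∉q⇒x∈p─q x∈F x∉E))
    ... | no _    | no x∉F  = inj₂ (inj₁ (x∉p⇒x∈∁p x∉F))
  ... | yes (v , v∈F─E) = narrow (small⊎large cM) (small⊎large cN)
    where
    v∈F : v ∈ F
    v∈F = p─q⊆p F E v∈F─E
    v∈∁X : v ∈ ∁ X
    v∈∁X = ⊆∁X cF v∈F
    cM : InClosed (E ∪ ancestors v)
    cM = InClosed-∪ cE InClosed-ancestors
    cN : InClosed (E ∪ strictAncestors v)
    cN = InClosed-∪ cE InClosed-strictAncestors
    narrow : Small (E ∪ ancestors v) ⊎ Large (E ∪ ancestors v) →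
             Small (E ∪ strictAncestors v) ⊎ Large (E ∪ strictAncestors v) → Sandwich
    narrow (inj₁ sM) _ = sandwich cM cF sM lF (rec (─-∪-⊂ v∈F─E (v∈ancestors v∈∁X)))
    narrow (inj₂ lM) (inj₁ sN) = record
      { centre = v ; centre∈∁X = v∈∁X
      ; lo = E ∪ strictAncestors v ; hi = E ∪ ancestors v
      ; lo-closed = cN ; hi-closed = cM ; lo-small = sN ; hi-large = lM
      ; hi─lo⊆component = ancestors─strictAncestors⊆component ∘ ∪-─-∪-⊆
      }
    narrow (inj₂ _) (inj₂ lN) = sandwich cE cN sE lN
      (rec (∪-─-⊂ (ancestors⊆ cF v∈F ∘ strictAncestors⊆ancestors) v∈F─E (v∉strictAncestors v∈∁X)))

  theSandwich : Sandwich
  theSandwich = sandwich InClosed-∅ InClosed-∁X Small-∅ Large-∁X (⊂-wellFounded _)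

  InAllBigSides : Subset (n G) → Set
  InAllBigSides C = ∀ A B → T A B → vs A ∩ vs B ≡ X → C ⊆ vs B

  module _ (s : Sandwich) where
    open Sandwich s

    component-inAllBigSides : InAllBigSides (component centre)
    component-inAllBigSides A B t A∩B {w} w∈C with w ∈? vs B
    ... | yes w∈B = w∈B
    ... | no w∉B  = ⊥-elim (¬covered t lo-small hi-large covers)
      where
      C⊆A : component centre ⊆ vs A
      C⊆A = stronglyConnected-⊆-side {A = A} {B} {C = component centre}
              (proj₁ (members A B t)) A∩B
              (proj₁ (proj₂ (proj₂ (component-isStrongComponent centre∈∁X)))) w∈C w∉B
      covers : ∀ x → x ∈ vs A ⊎ x ∈ lo ∪ X ⊎ x ∈ ∁ hi
      covers x with x ∈? lo ∪ X | x ∈? hi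
      ... | yes x∈lo∪X | _        = inj₂ (inj₁ x∈lo∪X)
      ... | no x∉lo∪X  | yes x∈hi =
        inj₁ (C⊆A (hi─lo⊆component (x∈p∧x∉q⇒x∈p─q x∈hi (x∉lo∪X ∘ x∈p∪q⁺ ∘ inj₁))))
      ... | no _       | no x∉hi  = inj₂ (inj₂ (x∉p⇒x∈∁p x∉hi))

    component-unique : IsStrongComponentMinus G X C → InAllBigSides C → C ≡ component centre
    component-unique {C} isC@(C⊆∁X , (w , w∈C) , _) inAllBigSides =
      strongComponents-≡ (component-isStrongComponent centre∈∁X) isC (hi─lo⊆component w∈hi─lo) w∈C
      where
      w∉lo : w ∉ lo
      w∉lo = x∈∁p⇒x∉p (inAllBigSides _ _ lo-small (lower∩upper≡X (⊆∁X lo-closed)) w∈C)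
      w∈hi : w ∈ hi
      w∈hi with x∈p∪q⁻ hi X (inAllBigSides _ _ hi-large (upper∩lower≡X (⊆∁X hi-closed)) w∈C)
      ... | inj₁ w∈hi = w∈hi
      ... | inj₂ w∈X  = ⊥-elim (x∈∁p⇒x∉p (C⊆∁X w∈C) w∈X)
      w∈hi─lo : w ∈ hi ─ lo
      w∈hi─lo = x∈p∧x∉q⇒x∈p─q w∈hi w∉lo

lemma5p9 : (G : Digraph) (k : ℕ) (T : Subgraph G → Subgraph G → Set) →
    IsTangle G k T → (X : Subset (n G)) → ∣ X ∣ < k →
    Σ (Subset (n G)) λ C →
      (IsStrongComponentMinus G X C
        × (∀ A B → T A B → vs A ∩ vs B ≡ X → C ⊆ vs B))
      × (∀ C′ → IsStrongComponentMinus G X C′ →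
           (∀ A B → T A B → vs A ∩ vs B ≡ X → C′ ⊆ vs B) → C′ ≡ C)
lemma5p9 G k T tangle X ∣X∣<k =
    component centre
  , (component-isStrongComponent centre∈∁X , component-inAllBigSides theSandwich)
  , λ _ → component-unique theSandwich
  where
  open InClosedSets G X
  open TangleAt G tangle X ∣X∣<k
  open Sandwich theSandwich
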